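{- Let $k\ge 2$ and $\delta=\frac{k+\lfloor k/2\rfloor}{2k}$. The deterministic online algorithm GBA (defined in the context) is $1/\delta$-competitive for $k$S2L-S: for every instance, the number of requests accepted by GBA is at least $\delta$ times the maximum number of requests that can be feasibly accepted by an offline algorithm knowing the whole instance.
   Context: Problem $k$S2L (car sharing with two locations). There are two locations $0$ and $1$ and $k$ servers. Time is divided into stages $i=1,2,3,\dots$. A request of a stage is either a "(0,1)" (pick up at location 0, drop off at location 1) or a "(1,0)" (pick up at 1, drop off at 0). Each server serves at most one request per stage; a server that serves a (0,1) in stage $i$ is at location 1 at the start of stage $i+1$ and can then only be used for a (1,0) (or left unused); symmetrically a server serving a (1,0) in stage $i$ can only be used for a (0,1) in stage $i+1$; a server unused in stage $i$ may be moved for free and used in stage $i+1$ for a request of either direction. Before stage 1 all servers count as unused. Formally, if $\ell_i,r_i$ denote the numbers of accepted (0,1)'s and (1,0)'s in stage $i$ and $f_i=k-\ell_i-r_i$, with $\ell_0=r_0=0$, $f_0=k$, a choice is feasible iff for all $i\ge1$: $\ell_i$ is at most the number of (0,1) requests of stage $i$, $r_i$ is at most the number of (1,0) requests of stage $i$, $\ell_i\le r_{i-1}+f_{i-1}$, $r_i\le \ell_{i-1}+f_{i-1}$, and $\ell_i+r_i\le k$. The profit is the total number of accepted requests; OPT denotes the maximum feasible profit of the (finite) instance. In the model $k$S2L-S, in each stage $i$ the online algorithm sees all requests of stage $i$ at once (i.e. the numbers $I\ell_i$ of (0,1)'s and $Ir_i$ of (1,0)'s of stage $i$), together with the past, and then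 decides how many of each to accept, without knowledge of future stages. An online algorithm is $1/\delta$-competitive ($0<\delta\le 1$) if on every instance its profit (expected profit, for randomized algorithms) is at least $\delta\cdot$OPT. Algorithm GBA. Let $G\ell_0=Gr_0=0$, $Gf_0=k$. In stage $i$, with $Gf_{i-1}=k-G\ell_{i-1}-Gr_{i-1}$, it accepts $G\ell_i$ (0,1)'s and $Gr_i$ (1,0)'s computed as follows. If $Gr_{i-1}+Gf_{i-1}\le\lfloor k/2\rfloor$ or $I\ell_i\le\lfloor k/2\rfloor$: $G\ell_i=\min\{I\ell_i,\,Gr_{i-1}+Gf_{i-1}\}$ and $Gr_i=\min\{Ir_i,\,G\ell_{i-1}+Gf_{i-1},\,k-G\ell_i\}$. Otherwise, if $G\ell_{i-1}+Gf_{i-1}\le\lfloor k/2\rfloor$ or $Ir_i\le\lfloor k/2\rfloor$: $Gr_i=\min\{Ir_i,\,G\ell_{i-1}+Gf_{i-1}\}$ and $G\ell_i=\min\{I\ell_i,\,Gr_{i-1}+Gf_{i-1},\,k-Gr_i\}$. Otherwise: $Gr_i=\lfloor k/2\rfloor$ and $G\ell_i=\lceil k/2\rceil$. -}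

module Defs where

open import Data.Nat using (ℕ; zero; suc; _+_; _*_; _∸_; _≤_; _≤ᵇ_; _⊓_; _/_)
open import Data.Bool using (Bool; true; false; if_then_else_; _∨_)
open import Data.Product using (_×_; _,_; proj₁; proj₂)
open import Data.List using (List; []; _∷_; length)
open import Data.Unit using (⊤)
open import Data.Empty using (⊥)

-- An instance of kS2L: a finite list of stages; stage i is the pair
-- (Iℓᵢ , Irᵢ) = (number of (0,1) requests , number of (1,0) requests).
Instance : Set
Instance = List (ℕ × ℕ)

Schedule : Set
Schedule = List (ℕ × ℕ)

FeasibleFrom : (k : ℕ) → ℕ × ℕ → Instance → Schedule → Set
FeasibleFrom k prev [] [] = ⊤
FeasibleFrom k prev [] (_ ∷ _) = ⊥
FeasibleFrom k prev (_ ∷ _) [] = ⊥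
FeasibleFrom k (lp , rp) ((Il , Ir) ∷ I) ((l , r) ∷ S) =
  (l ≤ Il) × (r ≤ Ir) ×
  (l ≤ rp + (k ∸ lp ∸ rp)) × (r ≤ lp + (k ∸ lp ∸ rp)) ×
  (l + r ≤ k) × FeasibleFrom k (l , r) I S

Feasible : (k : ℕ) → Instance → Schedule → Set
Feasible k I S = FeasibleFrom k (0 , 0) I S

profit : Schedule → ℕ
profit [] = 0
profit ((l , r) ∷ S) = l + r + profit S

gbaStep : ℕ → ℕ × ℕ → ℕ × ℕ → ℕ × ℕ
gbaStep k (lp , rp) (Il , Ir) =
  if ((rp + f) ≤ᵇ h) ∨ (Il ≤ᵇ h)
    then (let l = Il ⊓ (rp + f) in l , (Ir ⊓ (lp + f)) ⊓ (k ∸ l))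
    else (if ((lp + f) ≤ᵇ h) ∨ (Ir ≤ᵇ h)
      then (let r = Ir ⊓ (lp + f) in (Il ⊓ (rp + f)) ⊓ (k ∸ r) , r)
      else (k ∸ h , h))
  where
    f = k ∸ lp ∸ rp
    h = k / 2

gbaFrom : ℕ → ℕ × ℕ → Instance → Schedule
gbaFrom k prev [] = []
gbaFrom k prev (s ∷ I) = let g = gbaStep k prev s in g ∷ gbaFrom k g I

-- The schedule produced by GBA on an instance (online: stage i depends only
-- on stages 1..i by construction).
gba : ℕ → Instance → Schedule
gba k I = gbaFrom k (0 , 0) I

-- Amortised analysis, with h = ⌊k/2⌋. Compare, stage by stage, the numbers (a, b) of
-- (0,1)'s and (1,0)'s accepted by GBA with the numbers (l, r) accepted by any feasible
-- schedule. A potential Φ(a, b, l, r), with one term per direction that vanishes unless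
-- the schedule is ahead of GBA in that direction, satisfies
--     (k + h)(l + r)      ≤ 2k(a + b) + Φ         for all states, and
--     (k + h)(l + r) + Φ' ≤ 2k(a + b) + Φ         from each stage to the next,
-- so the stage inequalities telescope to (k + h)·profit(S) ≤ 2k·profit(GBA). The step
-- inequality uses only one property of GBA: it turns down a request of a direction only if
-- every server able to serve that direction does so, or all k servers are busy and at least
-- ⌈k/2⌉ (for (0,1)) resp. ⌊k/2⌋ (for (1,0)) of them serve it.
module Submission where

open import Defs
open import Data.Bool using (true; false; T; _∨_)
open import Data.Bool.Properties using (T-∨)
open import Data.Empty using (⊥-elim)
open import Data.List using ([]; _∷_)
open import Data.Nat using (ℕ; _+_; _*_; _∸_; _≤_; _<_; _≤ᵇ_; _⊓_; _/_; _≤?_; _≟_; z≤n)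
open import Data.Nat.DivMod using (m/n*n≤m)
open import Data.Nat.Properties
open import Algebra.Properties.CommutativeSemigroup +-commutativeSemigroup
  using (interchange; x∙yz≈xz∙y; xy∙z≈xz∙y)
open import Data.Nat.Tactic.RingSolver using (solve)
open import Data.Product using (_×_; _,_; proj₁; proj₂)
open import Data.Sum using (_⊎_; inj₁; inj₂; [_,_]′) renaming (map to ⊎-map)
open import Data.Unit using (tt)
open import Function.Base using (id)
open import Function.Bundles using (Equivalence)
open import Relation.Nullary using (yes; no)
open import Relation.Nullary.Decidable using (_×-dec_; _⊎-dec_)
open import Relation.Binary.PropositionalEquality

m+n+[m∸n]≡2*m : ∀ {m n} → n ≤ m → m + n + (m ∸ n) ≡ 2 * m
m+n+[m∸n]≡2*m {m} {n} n≤m = begin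
  m + n + (m ∸ n)   ≡⟨ +-assoc m n (m ∸ n) ⟩
  m + (n + (m ∸ n)) ≡⟨ cong (m +_) (m+[n∸m]≡n n≤m) ⟩
  m + m             ≡⟨ cong (m +_) (sym (+-identityʳ m)) ⟩
  2 * m             ∎
  where open ≡-Reasoning

[m+n]*m≡2*m*n+[m∸n]*m : ∀ {m n} → n ≤ m → (m + n) * m ≡ 2 * m * n + (m ∸ n) * m
[m+n]*m≡2*m*n+[m∸n]*m {m} {n} n≤m with m ∸ n | m+[n∸m]≡n n≤m
... | j | refl = solve (n ∷ j ∷ [])

m∸o≡[m∸n]+[n∸o] : ∀ {m n o} → o ≤ n → n ≤ m → m ∸ o ≡ (m ∸ n) + (n ∸ o)
m∸o≡[m∸n]+[n∸o] {m} {n} {o} o≤n n≤m =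
  trans (cong (_∸ o) (sym (m∸n+n≡m n≤m))) (+-∸-assoc (m ∸ n) o≤n)

n+[o∸m∸n]≡o∸m : ∀ m n {o} → m + n ≤ o → n + (o ∸ m ∸ n) ≡ o ∸ m
n+[o∸m∸n]≡o∸m m n {o} m+n≤o =
  trans (+-comm n _) (m∸n+n≡m (m+n≤o⇒m≤o∸n n (subst (_≤ o) (+-comm m n) m+n≤o)))

m+[o∸m∸n]≡o∸n : ∀ m n {o} → m + n ≤ o → m + (o ∸ m ∸ n) ≡ o ∸ n
m+[o∸m∸n]≡o∸n m n {o} m+n≤o = begin
  m + (o ∸ m ∸ n)   ≡⟨ cong (m +_) (∸-+-assoc o m n) ⟩
  m + (o ∸ (m + n)) ≡⟨ cong (λ p → m + (o ∸ p)) (+-comm m n) ⟩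
  m + (o ∸ (n + m)) ≡⟨ cong (m +_) (sym (∸-+-assoc o n m)) ⟩
  m + (o ∸ n ∸ m)   ≡⟨ m+[n∸m]≡n (m+n≤o⇒m≤o∸n m m+n≤o) ⟩
  o ∸ n             ∎
  where open ≡-Reasoning

m⊓n<m⇒m⊓n≡n : ∀ {m n} → m ⊓ n < m → m ⊓ n ≡ n
m⊓n<m⇒m⊓n≡n {m} {n} m⊓n<m with ⊓-sel m n
... | inj₁ m⊓n≡m = ⊥-elim (<-irrefl m⊓n≡m m⊓n<m)
... | inj₂ m⊓n≡n = m⊓n≡n

[m⊓n]⊓o<m⇒≡n⊎≡o : ∀ {m n o} → (m ⊓ n) ⊓ o < m →
  (m ⊓ n) ⊓ o ≡ n ⊎ (m ⊓ n) ⊓ o ≡ o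
[m⊓n]⊓o<m⇒≡n⊎≡o {m} {n} {o} <m with ⊓-sel (m ⊓ n) o
... | inj₁ e = inj₁ (trans e (m⊓n<m⇒m⊓n≡n (subst (_< m) e <m)))
... | inj₂ e = inj₂ e

≤ᵇ-∨-true⇒⊎ : ∀ {m n o} → (m ≤ᵇ o) ∨ (n ≤ᵇ o) ≡ true → m ≤ o ⊎ n ≤ o
≤ᵇ-∨-true⇒⊎ {m} {n} {o} e =
  ⊎-map (≤ᵇ⇒≤ m o) (≤ᵇ⇒≤ n o) (Equivalence.to T-∨ (subst T (sym e) tt))

n/2+n/2≤n : ∀ n → n / 2 + n / 2 ≤ n
n/2+n/2≤n n = begin
  n / 2 + n / 2       ≡⟨ cong (n / 2 +_) (+-identityʳ (n / 2)) ⟨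
  2 * (n / 2)         ≡⟨ *-comm 2 (n / 2) ⟩
  n / 2 * 2           ≤⟨ m/n*n≤m n 2 ⟩
  n                   ∎
  where open ≤-Reasoning

module Potential (k h : ℕ) (h+h≤k : h + h ≤ k) where

  h≤k : h ≤ k
  h≤k = ≤-trans (m≤m+n h h) h+h≤k

  h≤k∸h : h ≤ k ∸ h
  h≤k∸h = m+n≤o⇒m≤o∸n h h+h≤k

  k+h≤2*k : k + h ≤ 2 * k
  k+h≤2*k = +-monoʳ-≤ k (subst (h ≤_) (sym (+-identityʳ k)) h≤k)

  cap : ℕ
  cap = (k ∸ h) * k

  uncapped : ℕ → ℕ → ℕ
  uncapped a l = (k + h) * (l ∸ a) + (k ∸ h) * (k ∸ a)

  Settled : ℕ → ℕ → ℕ → ℕ → Set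
  Settled t s a l = l ≤ a ⊎ (s ≡ k × t ≤ a)

  -- a and l count the requests of one direction accepted by GBA and by the schedule,
  -- s is GBA's total and t the quota of that direction.
  sidePotential : ℕ → ℕ → ℕ → ℕ → ℕ
  sidePotential t s a l with (l ≤? a) ⊎-dec ((s ≟ k) ×-dec (t ≤? a)) | h ≤? a
  ... | yes _ | _     = 0
  ... | no _  | no _  = uncapped a l
  ... | no _  | yes _ = uncapped a l ⊓ cap

  potential : ℕ × ℕ → ℕ × ℕ → ℕ
  potential (a , b) (l , r) = sidePotential (k ∸ h) (a + b) a l + sidePotential h (a + b) b r

  settled⇒sidePotential≡0 : ∀ {t s a l} → Settled t s a l → sidePotential t s a l ≡ 0
  settled⇒sidePotential≡0 {t} {s} {a} {l} settled
    with (l ≤? a) ⊎-dec ((s ≟ k) ×-dec (t ≤? a)) | h ≤? a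
  ... | yes _        | _     = refl
  ... | no unsettled | _     = ⊥-elim (unsettled settled)

  sidePotential≤uncapped : ∀ t s a l → sidePotential t s a l ≤ uncapped a l
  sidePotential≤uncapped t s a l with (l ≤? a) ⊎-dec ((s ≟ k) ×-dec (t ≤? a)) | h ≤? a
  ... | yes _ | _     = z≤n
  ... | no _  | no _  = ≤-refl
  ... | no _  | yes _ = m⊓n≤m _ _

  sidePotential≤cap : ∀ t s a l → h ≤ a → sidePotential t s a l ≤ cap
  sidePotential≤cap t s a l h≤a with (l ≤? a) ⊎-dec ((s ≟ k) ×-dec (t ≤? a)) | h ≤? a
  ... | yes _ | _       = z≤n
  ... | no _  | no h≰a  = ⊥-elim (h≰a h≤a)
  ... | no _  | yes _   = m⊓n≤n _ _

  weighted≤uncapped : ∀ a l → (k + h) * l ≤ 2 * k * a + uncapped a l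
  weighted≤uncapped a l = begin
    (k + h) * l                                ≤⟨ *-monoʳ-≤ (k + h) (m≤n+m∸n l a) ⟩
    (k + h) * (a + (l ∸ a))                    ≡⟨ *-distribˡ-+ (k + h) a (l ∸ a) ⟩
    (k + h) * a + (k + h) * (l ∸ a)            ≤⟨ +-mono-≤ (*-monoˡ-≤ a k+h≤2*k) (m≤m+n _ _) ⟩
    2 * k * a + uncapped a l                   ∎
    where open ≤-Reasoning

  weighted≤cap : ∀ {a l} → h ≤ a → l ≤ k → (k + h) * l ≤ 2 * k * a + cap
  weighted≤cap {a} {l} h≤a l≤k = begin
    (k + h) * l          ≤⟨ *-monoʳ-≤ (k + h) l≤k ⟩
    (k + h) * k          ≡⟨ [m+n]*m≡2*m*n+[m∸n]*m h≤k ⟩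
    2 * k * h + cap      ≤⟨ +-monoˡ-≤ cap (*-monoʳ-≤ (2 * k) h≤a) ⟩
    2 * k * a + cap      ∎
    where open ≤-Reasoning

  weighted≤sidePotential : ∀ t s a l → l ≤ k →
    (k + h) * l ≤ 2 * k * a + sidePotential t s a l ⊎ (s ≡ k × t ≤ a)
  weighted≤sidePotential t s a l l≤k with (l ≤? a) ⊎-dec ((s ≟ k) ×-dec (t ≤? a)) | h ≤? a
  ... | yes (inj₁ l≤a) | _   = inj₁ (begin
    (k + h) * l   ≤⟨ *-mono-≤ k+h≤2*k l≤a ⟩
    2 * k * a     ≡⟨ +-identityʳ _ ⟨
    2 * k * a + 0 ∎)
    where open ≤-Reasoning
  ... | yes (inj₂ full) | _  = inj₂ full
  ... | no _ | no _          = inj₁ (weighted≤uncapped a l)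
  ... | no _ | yes h≤a       = inj₁ (begin
    (k + h) * l
      ≤⟨ ⊓-glb (weighted≤uncapped a l) (weighted≤cap h≤a l≤k) ⟩
    (2 * k * a + uncapped a l) ⊓ (2 * k * a + cap)
      ≡⟨ +-distribˡ-⊓ (2 * k * a) _ _ ⟨
    2 * k * a + (uncapped a l ⊓ cap)
      ∎)
    where open ≤-Reasoning

  weighted≤whenFull : ∀ a b l r n → a + b ≡ k → l + r ≤ k →
    (k + h) * (l + r) ≤ 2 * k * (a + b) + n
  weighted≤whenFull a b l r n full l+r≤k = begin
    (k + h) * (l + r)   ≤⟨ *-mono-≤ k+h≤2*k l+r≤k ⟩
    2 * k * k           ≡⟨ cong (2 * k *_) full ⟨
    2 * k * (a + b)     ≤⟨ m≤m+n _ n ⟩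
    2 * k * (a + b) + n ∎
    where open ≤-Reasoning

  weighted≤potential : ∀ a b l r → a + b ≤ k → l + r ≤ k →
    (k + h) * (l + r) ≤ 2 * k * (a + b) + potential (a , b) (l , r)
  weighted≤potential a b l r a+b≤k l+r≤k
    with weighted≤sidePotential (k ∸ h) (a + b) a l (m+n≤o⇒m≤o l l+r≤k)
       | weighted≤sidePotential h (a + b) b r (m+n≤o⇒n≤o l l+r≤k)
  ... | inj₂ (full , _) | _               = weighted≤whenFull a b l r _ full l+r≤k
  ... | inj₁ _          | inj₂ (full , _) = weighted≤whenFull a b l r _ full l+r≤k
  ... | inj₁ boundˡ     | inj₁ boundʳ     = begin
    (k + h) * (l + r)                           ≡⟨ *-distribˡ-+ (k + h) l r ⟩
    (k + h) * l + (k + h) * r                   ≤⟨ +-mono-≤ boundˡ boundʳ ⟩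
    (2 * k * a + Φˡ) + (2 * k * b + Φʳ)         ≡⟨ interchange (2 * k * a) Φˡ (2 * k * b) Φʳ ⟩
    (2 * k * a + 2 * k * b) + (Φˡ + Φʳ)         ≡⟨ cong (_+ (Φˡ + Φʳ)) (*-distribˡ-+ (2 * k) a b) ⟨
    2 * k * (a + b) + potential (a , b) (l , r) ∎
    where
    open ≤-Reasoning
    Φˡ Φʳ : ℕ
    Φˡ = sidePotential (k ∸ h) (a + b) a l
    Φʳ = sidePotential h (a + b) b r

  Saturated : ℕ → ℕ → ℕ → ℕ → Set
  Saturated t s u₀ u = u ≡ k ∸ u₀ ⊎ (s ≡ k × t ≤ u)

  -- GBA answers the requests (x, y) with (a', b') after accepting (a, b) in the previous
  -- stage; exactly k ∸ a servers are able to serve a (0,1) now.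
  record GreedyResponse (a b x y a' b' : ℕ) : Set where
    field
      rejects₀₁ : a' < x → Saturated (k ∸ h) (a' + b') a a'
      rejects₁₀ : b' < y → Saturated h (a' + b') b b'
      capacity  : a' + b' ≤ k

  open GreedyResponse

  prioritise₀₁ : ∀ {a b x y L R} → L ≡ k ∸ a → R ≡ k ∸ b → L ≤ h ⊎ x ≤ h →
    GreedyResponse a b x y (x ⊓ L) ((y ⊓ R) ⊓ (k ∸ (x ⊓ L)))
  prioritise₀₁ {a} {b} {x} {y} refl refl L≤h⊎x≤h = record
    { rejects₀₁ = λ u<x → inj₁ (m⊓n<m⇒m⊓n≡n u<x)
    ; rejects₁₀ = λ v<y → ⊎-map id fills ([m⊓n]⊓o<m⇒≡n⊎≡o v<y)
    ; capacity  = ≤-trans (+-monoʳ-≤ u (m⊓n≤n _ (k ∸ u))) (≤-reflexive (m+[n∸m]≡n u≤k))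
    }
    where
    u : ℕ
    u = x ⊓ (k ∸ a)
    u≤k : u ≤ k
    u≤k = ≤-trans (m⊓n≤n x (k ∸ a)) (m∸n≤m k a)
    u≤h : u ≤ h
    u≤h = [ m≤n⇒o⊓m≤n x , m≤n⇒m⊓o≤n (k ∸ a) ]′ L≤h⊎x≤h
    fills : ∀ {v} → v ≡ k ∸ u → u + v ≡ k × h ≤ v
    fills refl = m+[n∸m]≡n u≤k , ≤-trans h≤k∸h (∸-monoʳ-≤ k u≤h)

  prioritise₁₀ : ∀ {a b x y L R} → L ≡ k ∸ a → R ≡ k ∸ b → R ≤ h ⊎ y ≤ h →
    GreedyResponse a b x y ((x ⊓ L) ⊓ (k ∸ (y ⊓ R))) (y ⊓ R)
  prioritise₁₀ {a} {b} {x} {y} refl refl R≤h⊎y≤h = record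
    { rejects₀₁ = λ u<x → ⊎-map id fills ([m⊓n]⊓o<m⇒≡n⊎≡o u<x)
    ; rejects₁₀ = λ v<y → inj₁ (m⊓n<m⇒m⊓n≡n v<y)
    ; capacity  = ≤-trans (+-monoˡ-≤ v (m⊓n≤n _ (k ∸ v))) (≤-reflexive (m∸n+n≡m v≤k))
    }
    where
    v : ℕ
    v = y ⊓ (k ∸ b)
    v≤k : v ≤ k
    v≤k = ≤-trans (m⊓n≤n y (k ∸ b)) (m∸n≤m k b)
    v≤h : v ≤ h
    v≤h = [ m≤n⇒o⊓m≤n y , m≤n⇒m⊓o≤n (k ∸ b) ]′ R≤h⊎y≤h
    fills : ∀ {u} → u ≡ k ∸ v → u + v ≡ k × k ∸ h ≤ u
    fills refl = m∸n+n≡m v≤k , ∸-monoʳ-≤ k v≤h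

  split : ∀ {a b x y} → GreedyResponse a b x y (k ∸ h) h
  split = record
    { rejects₀₁ = λ _ → inj₂ (m∸n+n≡m h≤k , ≤-refl)
    ; rejects₁₀ = λ _ → inj₂ (m∸n+n≡m h≤k , ≤-refl)
    ; capacity  = ≤-reflexive (m∸n+n≡m h≤k)
    }

  settled-or-saturated : ∀ {t s u₀ u x l'} → (u < x → Saturated t s u₀ u) → l' ≤ x →
    Settled t s u l' ⊎ (u ≡ k ∸ u₀ × u < l')
  settled-or-saturated {u = u} {l' = l'} rejects l'≤x with l' ≤? u
  ... | yes l'≤u = inj₁ (inj₁ l'≤u)
  ... | no l'≰u with rejects (<-≤-trans (≰⇒> l'≰u) l'≤x)
  ...   | inj₁ u≡k∸u₀ = inj₂ (u≡k∸u₀ , ≰⇒> l'≰u)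
  ...   | inj₂ full   = inj₁ (inj₂ full)

  weighted+uncapped≤ : ∀ {a l l'} → l ≤ a → a ≤ k → l' ≤ k ∸ l →
    (k + h) * l + uncapped (k ∸ a) l' ≤ 2 * k * a
  weighted+uncapped≤ {a} {l} {l'} l≤a a≤k l'≤k∸l = begin
    (k + h) * l + uncapped (k ∸ a) l'
      ≤⟨ +-monoʳ-≤ ((k + h) * l) (+-mono-≤ (*-monoʳ-≤ (k + h) surplus)
                                            (≤-reflexive (cong ((k ∸ h) *_) (m∸[m∸n]≡n a≤k)))) ⟩
    (k + h) * l + ((k + h) * (a ∸ l) + (k ∸ h) * a)
      ≡⟨ +-assoc ((k + h) * l) _ _ ⟨
    (k + h) * l + (k + h) * (a ∸ l) + (k ∸ h) * a
      ≡⟨ cong (_+ (k ∸ h) * a) (*-distribˡ-+ (k + h) l (a ∸ l)) ⟨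
    (k + h) * (l + (a ∸ l)) + (k ∸ h) * a
      ≡⟨ cong (λ n → (k + h) * n + (k ∸ h) * a) (m+[n∸m]≡n l≤a) ⟩
    (k + h) * a + (k ∸ h) * a
      ≡⟨ *-distribʳ-+ a (k + h) (k ∸ h) ⟨
    (k + h + (k ∸ h)) * a
      ≡⟨ cong (_* a) (m+n+[m∸n]≡2*m h≤k) ⟩
    2 * k * a
      ∎
    where
    open ≤-Reasoning
    -- The schedule had only k ∸ l servers for (0,1)'s, so its surplus over GBA's k ∸ a
    -- is covered by its deficit a ∸ l in the previous stage.
    surplus : l' ∸ (k ∸ a) ≤ a ∸ l
    surplus = m≤n+o⇒m∸n≤o l' (k ∸ a) (subst (l' ≤_) (m∸o≡[m∸n]+[n∸o] l≤a a≤k) l'≤k∸l)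

  saturated-step : ∀ {t s a b l r l' m} → a + b ≤ k → l + r ≤ k →
    k ∸ a < l' → l' ≤ k ∸ l →
    (k + h) * r ≤ 2 * k * b + m ⊎ (a + b ≡ k × h ≤ b) →
    (k + h) * (l + r) + sidePotential t s (k ∸ a) l' ≤ 2 * k * (a + b) + m
  saturated-step {t} {s} {a} {b} {l} {r} {l'} {m} _ l+r≤k _ _ (inj₂ (full , h≤b)) = begin
    (k + h) * (l + r) + sidePotential t s (k ∸ a) l'
      ≤⟨ +-mono-≤ (*-monoʳ-≤ (k + h) l+r≤k) (sidePotential≤cap t s (k ∸ a) l' h≤k∸a) ⟩
    (k + h) * k + cap         ≡⟨ *-distribʳ-+ k (k + h) (k ∸ h) ⟨
    (k + h + (k ∸ h)) * k     ≡⟨ cong (_* k) (m+n+[m∸n]≡2*m h≤k) ⟩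
    2 * k * k                 ≡⟨ cong (2 * k *_) full ⟨
    2 * k * (a + b)           ≤⟨ m≤m+n _ m ⟩
    2 * k * (a + b) + m       ∎
    where
    open ≤-Reasoning
    h≤k∸a : h ≤ k ∸ a
    h≤k∸a = subst (h ≤_) (sym (trans (cong (_∸ a) (sym full)) (m+n∸m≡n a b))) h≤b
  saturated-step {t} {s} {a} {b} {l} {r} {l'} {m} a+b≤k _ k∸a<l' l'≤k∸l (inj₁ boundʳ)
    with l ≤? a
  ... | no l≰a =
    ⊥-elim (<⇒≱ k∸a<l' (≤-trans l'≤k∸l (∸-monoʳ-≤ k (<⇒≤ (≰⇒> l≰a)))))
  ... | yes l≤a = begin
    (k + h) * (l + r) + Φ           ≡⟨ cong (_+ Φ) (*-distribˡ-+ (k + h) l r) ⟩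
    (k + h) * l + (k + h) * r + Φ   ≡⟨ xy∙z≈xz∙y ((k + h) * l) _ Φ ⟩
    ((k + h) * l + Φ) + (k + h) * r ≤⟨ +-mono-≤ boundˡ boundʳ ⟩
    2 * k * a + (2 * k * b + m)     ≡⟨ +-assoc (2 * k * a) _ m ⟨
    2 * k * a + 2 * k * b + m       ≡⟨ cong (_+ m) (*-distribˡ-+ (2 * k) a b) ⟨
    2 * k * (a + b) + m             ∎
    where
    open ≤-Reasoning
    Φ : ℕ
    Φ = sidePotential t s (k ∸ a) l'
    boundˡ : (k + h) * l + Φ ≤ 2 * k * a
    boundˡ = ≤-trans (+-monoʳ-≤ _ (sidePotential≤uncapped t s (k ∸ a) l'))
                     (weighted+uncapped≤ l≤a (m+n≤o⇒m≤o a a+b≤k) l'≤k∸l)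

  step-settled : ∀ a b l r {a' b' l' r'} → a + b ≤ k → l + r ≤ k →
    Settled (k ∸ h) (a' + b') a' l' → Settled h (a' + b') b' r' →
    (k + h) * (l + r) + potential (a' , b') (l' , r')
      ≤ 2 * k * (a + b) + potential (a , b) (l , r)
  step-settled a b l r {a'} {b'} {l'} {r'} a+b≤k l+r≤k settledˡ settledʳ = begin
    (k + h) * (l + r) + potential (a' , b') (l' , r')
      ≡⟨ cong ((k + h) * (l + r) +_) (cong₂ _+_ (settled⇒sidePotential≡0 settledˡ)
                                                (settled⇒sidePotential≡0 settledʳ)) ⟩
    (k + h) * (l + r) + 0                       ≡⟨ +-identityʳ _ ⟩
    (k + h) * (l + r)                           ≤⟨ weighted≤potential a b l r a+b≤k l+r≤k ⟩
    2 * k * (a + b) + potential (a , b) (l , r) ∎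
    where open ≤-Reasoning

  step-saturated₀₁ : ∀ a b l r {b' l' r'} → a + b ≤ k → l + r ≤ k →
    k ∸ a < l' → l' ≤ k ∸ l → Settled h (k ∸ a + b') b' r' →
    (k + h) * (l + r) + potential (k ∸ a , b') (l' , r')
      ≤ 2 * k * (a + b) + potential (a , b) (l , r)
  step-saturated₀₁ a b l r {b'} {l'} {r'} a+b≤k l+r≤k k∸a<l' l'≤k∸l settledʳ = begin
    (k + h) * (l + r) + (Φ' + Φ'ʳ)
      ≡⟨ cong (λ n → (k + h) * (l + r) + (Φ' + n)) (settled⇒sidePotential≡0 settledʳ) ⟩
    (k + h) * (l + r) + (Φ' + 0)
      ≡⟨ cong ((k + h) * (l + r) +_) (+-identityʳ Φ') ⟩
    (k + h) * (l + r) + Φ'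
      ≤⟨ saturated-step a+b≤k l+r≤k k∸a<l' l'≤k∸l
           (weighted≤sidePotential h (a + b) b r (m+n≤o⇒n≤o l l+r≤k)) ⟩
    2 * k * (a + b) + Φʳ
      ≤⟨ +-monoʳ-≤ (2 * k * (a + b)) (m≤n+m Φʳ _) ⟩
    2 * k * (a + b) + potential (a , b) (l , r)
      ∎
    where
    open ≤-Reasoning
    Φ' Φ'ʳ Φʳ : ℕ
    Φ' = sidePotential (k ∸ h) (k ∸ a + b') (k ∸ a) l'
    Φ'ʳ = sidePotential h (k ∸ a + b') b' r'
    Φʳ = sidePotential h (a + b) b r

  step-saturated₁₀ : ∀ a b l r {a' l' r'} → a + b ≤ k → l + r ≤ k →
    k ∸ b < r' → r' ≤ k ∸ r → Settled (k ∸ h) (a' + (k ∸ b)) a' l' →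
    (k + h) * (l + r) + potential (a' , k ∸ b) (l' , r')
      ≤ 2 * k * (a + b) + potential (a , b) (l , r)
  step-saturated₁₀ a b l r {a'} {l'} {r'} a+b≤k l+r≤k k∸b<r' r'≤k∸r settledˡ = begin
    (k + h) * (l + r) + (Φ'ˡ + Φ')
      ≡⟨ cong (λ n → (k + h) * (l + r) + (n + Φ')) (settled⇒sidePotential≡0 settledˡ) ⟩
    (k + h) * (l + r) + Φ'
      ≡⟨ cong (λ n → (k + h) * n + Φ') (+-comm l r) ⟩
    (k + h) * (r + l) + Φ'
      ≤⟨ saturated-step (subst (_≤ k) (+-comm a b) a+b≤k) (subst (_≤ k) (+-comm l r) l+r≤k)
                        k∸b<r' r'≤k∸r boundˡ ⟩
    2 * k * (b + a) + Φˡ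
      ≡⟨ cong (λ n → 2 * k * n + Φˡ) (+-comm b a) ⟩
    2 * k * (a + b) + Φˡ
      ≤⟨ +-monoʳ-≤ (2 * k * (a + b)) (m≤m+n Φˡ _) ⟩
    2 * k * (a + b) + potential (a , b) (l , r)
      ∎
    where
    open ≤-Reasoning
    Φ'ˡ Φ' Φˡ : ℕ
    Φ'ˡ = sidePotential (k ∸ h) (a' + (k ∸ b)) a' l'
    Φ' = sidePotential h (a' + (k ∸ b)) (k ∸ b) r'
    Φˡ = sidePotential (k ∸ h) (a + b) a l
    boundˡ : (k + h) * l ≤ 2 * k * a + Φˡ ⊎ (b + a ≡ k × h ≤ a)
    boundˡ = ⊎-map id (λ (full , k∸h≤a) → trans (+-comm b a) full , ≤-trans h≤k∸h k∸h≤a)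
                   (weighted≤sidePotential (k ∸ h) (a + b) a l (m+n≤o⇒m≤o l l+r≤k))

  not-both-saturated : ∀ a b {l' r'} → a + b ≤ k → k ∸ a < l' → k ∸ b < r' → k < l' + r'
  not-both-saturated a b {l'} {r'} a+b≤k k∸a<l' k∸b<r' = begin-strict
    k                 ≤⟨ m≤n+m∸n k b ⟩
    b + (k ∸ b)       ≤⟨ +-monoˡ-≤ (k ∸ b) b≤k∸a ⟩
    (k ∸ a) + (k ∸ b) <⟨ +-mono-< k∸a<l' k∸b<r' ⟩
    l' + r'           ∎
    where
    open ≤-Reasoning
    b≤k∸a : b ≤ k ∸ a
    b≤k∸a = m+n≤o⇒m≤o∸n b (subst (_≤ k) (+-comm a b) a+b≤k)

  potential-step : ∀ a b l r {x y a' b' l' r'} → a + b ≤ k → l + r ≤ k →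
    GreedyResponse a b x y a' b' → l' ≤ x → r' ≤ y →
    l' ≤ k ∸ l → r' ≤ k ∸ r → l' + r' ≤ k →
    (k + h) * (l + r) + potential (a' , b') (l' , r')
      ≤ 2 * k * (a + b) + potential (a , b) (l , r)
  potential-step a b l r a+b≤k l+r≤k response l'≤x r'≤y l'≤k∸l r'≤k∸r l'+r'≤k
    with settled-or-saturated {u₀ = a} (rejects₀₁ response) l'≤x
       | settled-or-saturated {u₀ = b} (rejects₁₀ response) r'≤y
  ... | inj₁ settledˡ        | inj₁ settledʳ        =
    step-settled a b l r a+b≤k l+r≤k settledˡ settledʳ
  ... | inj₂ (refl , k∸a<l') | inj₁ settledʳ        =
    step-saturated₀₁ a b l r a+b≤k l+r≤k k∸a<l' l'≤k∸l settledʳ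
  ... | inj₁ settledˡ        | inj₂ (refl , k∸b<r') =
    step-saturated₁₀ a b l r a+b≤k l+r≤k k∸b<r' r'≤k∸r settledˡ
  ... | inj₂ (refl , k∸a<l') | inj₂ (refl , k∸b<r') =
    ⊥-elim (<⇒≱ (not-both-saturated a b a+b≤k k∸a<l' k∸b<r') l'+r'≤k)

module _ (k : ℕ) where

  open Potential k (k / 2) (n/2+n/2≤n k)
  open GreedyResponse using (capacity)

  gbaStep-greedy : ∀ {a b} x y → a + b ≤ k →
    GreedyResponse a b x y (proj₁ (gbaStep k (a , b) (x , y))) (proj₂ (gbaStep k (a , b) (x , y)))
  gbaStep-greedy {a} {b} x y a+b≤k
    with (b + (k ∸ a ∸ b) ≤ᵇ k / 2) ∨ (x ≤ᵇ k / 2) in prefer₀₁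
  ... | true =
    prioritise₀₁ (n+[o∸m∸n]≡o∸m a b a+b≤k) (m+[o∸m∸n]≡o∸n a b a+b≤k)
                 (≤ᵇ-∨-true⇒⊎ prefer₀₁)
  ... | false with (a + (k ∸ a ∸ b) ≤ᵇ k / 2) ∨ (y ≤ᵇ k / 2) in prefer₁₀
  ...   | true  =
    prioritise₁₀ (n+[o∸m∸n]≡o∸m a b a+b≤k) (m+[o∸m∸n]≡o∸n a b a+b≤k)
                 (≤ᵇ-∨-true⇒⊎ prefer₁₀)
  ...   | false = split

  amortised : ∀ I S a b l r → a + b ≤ k → l + r ≤ k → FeasibleFrom k (l , r) I S →
    (k + k / 2) * profit ((l , r) ∷ S)
      ≤ 2 * k * profit ((a , b) ∷ gbaFrom k (a , b) I) + potential (a , b) (l , r)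
  amortised [] [] a b l r a+b≤k l+r≤k _ = begin
    (k + k / 2) * (l + r + 0)          ≡⟨ cong ((k + k / 2) *_) (+-identityʳ (l + r)) ⟩
    (k + k / 2) * (l + r)              ≤⟨ weighted≤potential a b l r a+b≤k l+r≤k ⟩
    2 * k * (a + b) + Φ                ≡⟨ cong (λ n → 2 * k * n + Φ) (+-identityʳ (a + b)) ⟨
    2 * k * (a + b + 0) + Φ            ∎
    where
    open ≤-Reasoning
    Φ : ℕ
    Φ = potential (a , b) (l , r)
  amortised ((x , y) ∷ I) ((l' , r') ∷ S) a b l r a+b≤k l+r≤k
            (l'≤x , r'≤y , l'≤free , r'≤free , l'+r'≤k , feasible) = begin
    (k + k / 2) * (l + r + P)
      ≡⟨ *-distribˡ-+ (k + k / 2) (l + r) P ⟩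
    (k + k / 2) * (l + r) + (k + k / 2) * P
      ≤⟨ +-monoʳ-≤ _ (amortised I S a' b' l' r' (capacity response) l'+r'≤k feasible) ⟩
    (k + k / 2) * (l + r) + (2 * k * G + Φ')
      ≡⟨ x∙yz≈xz∙y ((k + k / 2) * (l + r)) (2 * k * G) Φ' ⟩
    (k + k / 2) * (l + r) + Φ' + 2 * k * G
      ≤⟨ +-monoˡ-≤ (2 * k * G) (potential-step a b l r a+b≤k l+r≤k response l'≤x r'≤y
                                  (subst (l' ≤_) (n+[o∸m∸n]≡o∸m l r l+r≤k) l'≤free)
                                  (subst (r' ≤_) (m+[o∸m∸n]≡o∸n l r l+r≤k) r'≤free) l'+r'≤k) ⟩
    2 * k * (a + b) + Φ + 2 * k * G
      ≡⟨ xy∙z≈xz∙y (2 * k * (a + b)) Φ (2 * k * G) ⟩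
    2 * k * (a + b) + 2 * k * G + Φ
      ≡⟨ cong (_+ Φ) (*-distribˡ-+ (2 * k) (a + b) G) ⟨
    2 * k * (a + b + G) + Φ
      ∎
    where
    open ≤-Reasoning
    a' b' P G Φ Φ' : ℕ
    a' = proj₁ (gbaStep k (a , b) (x , y))
    b' = proj₂ (gbaStep k (a , b) (x , y))
    P = profit ((l' , r') ∷ S)
    G = profit ((a' , b') ∷ gbaFrom k (a' , b') I)
    Φ = potential (a , b) (l , r)
    Φ' = potential (a' , b') (l' , r')
    response : GreedyResponse a b x y a' b'
    response = gbaStep-greedy x y a+b≤k

-- The bound holds for every k.
theorem1 : (k : ℕ) → 2 ≤ k → (I : Instance) → (S : Schedule) →
    Feasible k I S →
    (k + k / 2) * profit S ≤ (2 * k) * profit (gba k I)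
theorem1 k _ I S feasible = begin
  (k + k / 2) * profit S          ≤⟨ amortised k I S 0 0 0 0 z≤n z≤n feasible ⟩
  2 * k * profit (gba k I) + 0    ≡⟨ +-identityʳ _ ⟩
  2 * k * profit (gba k I)        ∎
  where open ≤-Reasoning
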